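{- Let $R$ be a connected digraph (request graph). If there exists a tree solution for MinCRS on $R$, then $R$ is walk-Helly.
   Context: A temporal graph is a pair $\mathcal G=(V,\mathcal E)$ where $\mathcal E$ is a finite set of (distinct) temporal edges $(\{u,v\},t)$ with $u\neq v\in V$ and $t$ a positive integer. A journey from $u_0$ to $u_k$ is a sequence $(u_0,u_1,t_0),\dots,(u_{k-1},u_k,t_{k-1})$ with each $(\{u_i,u_{i+1}\},t_i)\in\mathcal E$ and $t_0<\dots<t_{k-1}$. The footprint of $\mathcal G$ is the undirected graph on $V$ with edge set $\{\{u,v\}:(\{u,v\},t)\in\mathcal E\text{ for some }t\}$. A solution for $R=(V,A)$ is a temporal graph on $V$ with a journey from $u$ to $v$ for every arc $(u,v)\in A$; for connected $R$ (underlying undirected graph connected), a tree solution is a solution with exactly $n-1$ temporal edges ($n=|V|$), so that its footprint is a tree. A closed walk of a digraph is a sequence $(u_0,\dots,u_k)$, $k\ge1$, with $(u_i,u_{i+1})$ an arc and $u_k=u_0$. $R$ is walk-Helly if any set of pairwise non-vertex-disjoint closed walks of $R$ all share a common vertex. -}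

module Defs where

open import Data.Nat using (ℕ; zero; suc; _<_; _∸_)
open import Data.Fin using (Fin; zero; suc; inject₁; fromℕ)
open import Data.Product using (Σ; ∃; ∃-syntax; _×_; _,_)
open import Data.Sum using (_⊎_)
open import Data.List using (List; length)
open import Data.List.Membership.Propositional using (_∈_)
open import Data.List.Relation.Unary.All using (All)
open import Data.List.Relation.Unary.AllPairs using (AllPairs)
open import Relation.Nullary using (¬_)
open import Relation.Binary.PropositionalEquality using (_≡_; _≢_)
open import Relation.Binary.Construct.Closure.ReflexiveTransitive using (Star)

Digraph : ℕ → Set₁
Digraph n = Fin n → Fin n → Set

Loopless : {n : ℕ} → Digraph n → Set
Loopless {n} A = (u : Fin n) → ¬ A u u

Connected : {n : ℕ} → Digraph n → Set
Connected {n} A = (u v : Fin n) → Star (λ x y → A x y ⊎ A y x) u v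

-- A temporal edge ({u,v},t), stored as an (arbitrarily oriented) triple.
record TEdge (n : ℕ) : Set where
  constructor tedge
  field
    end₁ : Fin n
    end₂ : Fin n
    time : ℕ
open TEdge public

WellFormed : {n : ℕ} → TEdge n → Set
WellFormed e = (end₁ e ≢ end₂ e) × (0 < time e)

SameEdge : {n : ℕ} → TEdge n → TEdge n → Set
SameEdge e f = (time e ≡ time f) ×
  (((end₁ e ≡ end₁ f) × (end₂ e ≡ end₂ f)) ⊎ ((end₁ e ≡ end₂ f) × (end₂ e ≡ end₁ f)))

record TemporalGraph (n : ℕ) : Set where
  constructor temporalGraph
  field
    edges    : List (TEdge n)
    wf       : All WellFormed edges
    distinct : AllPairs (λ e f → ¬ SameEdge e f) edges
open TemporalGraph public

HasEdge : {n : ℕ} → TemporalGraph n → Fin n → Fin n → ℕ → Set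
HasEdge G x y t = (tedge x y t ∈ edges G) ⊎ (tedge y x t ∈ edges G)

data JourneyAfter {n : ℕ} (G : TemporalGraph n) : ℕ → Fin n → Fin n → Set where
  here : ∀ {t x} → JourneyAfter G t x x
  step : ∀ {t s x y z} → HasEdge G x y s → t < s → JourneyAfter G s y z → JourneyAfter G t x z

-- A journey from x to y (times are positive, so "after 0" imposes nothing).
Journey : {n : ℕ} → TemporalGraph n → Fin n → Fin n → Set
Journey G x y = JourneyAfter G 0 x y

IsSolution : {n : ℕ} → Digraph n → TemporalGraph n → Set
IsSolution {n} A G = (u v : Fin n) → A u v → Journey G u v

IsTreeSolution : {n : ℕ} → Digraph n → TemporalGraph n → Set
IsTreeSolution {n} A G = IsSolution A G × (length (edges G) ≡ n ∸ 1)

record ClosedWalk {n : ℕ} (A : Digraph n) : Set where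
  constructor closedWalk
  field
    len     : ℕ
    len≥1   : 0 < len
    vertex  : Fin (suc len) → Fin n
    arcs    : (i : Fin len) → A (vertex (inject₁ i)) (vertex (suc i))
    closed  : vertex (fromℕ len) ≡ vertex zero
open ClosedWalk public

OnWalk : {n : ℕ} {A : Digraph n} → Fin n → ClosedWalk A → Set
OnWalk v W = ∃[ i ] vertex W i ≡ v

WalkHelly : {n : ℕ} → Digraph n → Set
WalkHelly {n} A =
  (Ws : List (ClosedWalk A)) →
  (∃[ W ] (W ∈ Ws)) →
  (∀ {W W'} → W ∈ Ws → W' ∈ Ws → ∃[ v ] (OnWalk v W × OnWalk v W')) →
  ∃[ v ] (∀ {W} → W ∈ Ws → OnWalk v W)

-- Any solution makes the vertex set of a closed walk of R journey-connected: two of its vertices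
-- are joined by a chain of journeys between vertices of the walk. When the footprint is a forest,
-- pairwise intersecting journey-connected sets have a common vertex. This goes by induction on
-- the number of temporal edges, removing an edge g = {x, y} of maximal time. Such an edge can only
-- be the last hop of a journey, and removing it separates the component X of x from the
-- component Y of y. A journey-connected set either stays journey-connected without g, or contains
-- x and y and lies in X ∪ Y; collapsing Y onto x shows that its trace on X is journey-connected
-- without g. If some member is of the second kind, every member of the first kind meets it and so
-- lies inside X or inside Y; as these members pairwise intersect they all lie on the same side, and
-- trimming every member to that side gives a family to which the induction hypothesis applies.

{-# OPTIONS --safe #-}
module Submission where

open import Defs
open import Level using (0ℓ)
open import Function using (_∘_)
open import Data.Nat using (ℕ; zero; suc; _<_; _≤_; _∸_; _+_; z≤n; s≤s; _≤?_)
open import Data.Nat.Properties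
  using (module ≤-Reasoning; ≤-reflexive; <⇒≱; n<1+n; <-irrefl; +-suc; +-identityʳ; +-monoˡ-≤; m∸n≤m;
         suc-pred; suc-injective)
open import Data.Fin using (Fin; zero; suc; inject₁; fromℕ)
open import Data.Fin.Properties using (_≟_; any?; all?; nonZeroIndex)
open import Data.Product using (∃₂; ∃-syntax; _×_; _,_; proj₁; map₁)
open import Data.Sum using (_⊎_; inj₁; inj₂; swap)
import Data.Sum as Sum
open import Data.Empty using (⊥; ⊥-elim)
open import Data.List using (List; []; _∷_; _++_; length; lookup; filter; allFin)
open import Data.List.Properties using (filter-all; length-tabulate)
open import Data.List.Extrema.Nat using (argmax; argmax-sel; f[⊥]≤f[argmax]; f[xs]≤f[argmax])
open import Data.List.Membership.Propositional using (_∈_)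
open import Data.List.Membership.Propositional.Properties using (∈-∃++; ∈-lookup)
open import Data.List.Relation.Binary.Subset.Propositional using (_⊆_)
open import Data.List.Relation.Binary.Permutation.Propositional using (_↭_)
open import Data.List.Relation.Binary.Permutation.Propositional.Properties
  using (shift; ↭-length; ∈-resp-↭)
open import Data.List.Relation.Unary.Any using (here; there; index)
open import Data.List.Relation.Unary.Any.Properties using (lookup-index)
open import Data.List.Relation.Unary.All using (All; []; _∷_)
import Data.List.Relation.Unary.All as All
open import Data.List.Relation.Unary.All.Properties using (all-filter)
open import Data.List.Relation.Unary.AllPairs using (AllPairs; []; _∷_)
import Data.List.Relation.Unary.AllPairs as AllPairs
open import Data.List.Relation.Unary.AllPairs.Properties using (filter⁺)
open import Data.List.Relation.Unary.Unique.Propositional.Properties using (allFin⁺)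
open import Effect.Monad using (RawMonad)
open import Relation.Nullary using (¬_; Dec; yes; no)
open import Relation.Nullary.Decidable using (decidable-stable; ¬¬-excluded-middle)
open import Relation.Nullary.Negation using (¬¬-Monad; ¬¬-map)
open import Relation.Unary using (Pred; Decidable; _∩_)
open import Relation.Unary.Properties using (∁?)
open import Relation.Binary using (Rel)
open import Relation.Binary.PropositionalEquality using (_≡_; refl; sym; trans; cong; subst; subst₂)
open import Relation.Binary.Construct.Closure.ReflexiveTransitive using (Star; ε; _◅_; _◅◅_; reverse)
import Relation.Binary.Construct.Closure.ReflexiveTransitive as Star

open RawMonad (¬¬-Monad {0ℓ})

private
  variable
    n : ℕ
    L L' : List (TEdge n)

¬¬-Π-Fin : ∀ {k} {P : Pred (Fin k) 0ℓ} → (∀ i → ¬ ¬ P i) → ¬ ¬ (∀ i → P i)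
¬¬-Π-Fin {zero} _ = pure λ ()
¬¬-Π-Fin {suc k} {P} h = do
  p₀ ← h zero
  ps ← ¬¬-Π-Fin {P = P ∘ suc} (h ∘ suc)
  pure λ { zero → p₀ ; (suc i) → ps i }

AllPairs-strengthen : ∀ {A : Set} {P : Pred A 0ℓ} {R S : Rel A 0ℓ} →
  (∀ {u v} → P u → P v → R u v → S u v) → ∀ {xs} → All P xs → AllPairs R xs → AllPairs S xs
AllPairs-strengthen f [] [] = []
AllPairs-strengthen f (pu ∷ ps) (rs ∷ rss) =
  All.zipWith (λ (pv , ruv) → f pu pv ruv) (ps , rs) ∷ AllPairs-strengthen f ps rss

length≤1+length-filter : ∀ {A : Set} {P : Pred A 0ℓ} {R : Rel A 0ℓ} (P? : Decidable P) →
  (∀ {u v} → ¬ P u → ¬ P v → ¬ R u v) → ∀ {xs} → AllPairs R xs → length xs ≤ suc (length (filter P? xs))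
length≤1+length-filter P? rejected-unrelated [] = z≤n
length≤1+length-filter {P = P} {R} P? rejected-unrelated {x ∷ xs} (rs ∷ rss) with P? x
... | yes _ = s≤s (length≤1+length-filter P? rejected-unrelated rss)
... | no ¬px = s≤s (≤-reflexive (sym (cong length (filter-all P? (All.map accepted rs)))))
  where
  accepted : ∀ {y} → R x y → P y
  accepted {y} rxy = decidable-stable (P? y) λ ¬py → rejected-unrelated ¬px ¬py rxy

argmax-∈ : ∀ {A : Set} (f : A → ℕ) x xs → argmax f x xs ∈ x ∷ xs
argmax-∈ f x xs = Sum.[ here , there ]′ (argmax-sel f x xs)

∈-∃↭ : ∀ {A : Set} {x : A} {xs} → x ∈ xs → ∃[ ys ] (xs ↭ x ∷ ys)
∈-∃↭ x∈xs with ∈-∃++ x∈xs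
... | ys , zs , refl = ys ++ zs , shift _ ys zs

module _ {A : Set} {T : Rel A 0ℓ} where

  star-from-zero : ∀ m (f : Fin (suc m) → A) → (∀ i → T (f (inject₁ i)) (f (suc i))) →
    ∀ j → Star T (f zero) (f j)
  star-from-zero m f steps zero = ε
  star-from-zero (suc m) f steps (suc j) =
    star-from-zero m (f ∘ inject₁) (steps ∘ inject₁) j ◅◅ (steps j ◅ ε)

  star-to-last : ∀ m (f : Fin (suc m) → A) → (∀ i → T (f (inject₁ i)) (f (suc i))) →
    ∀ i → Star T (f i) (f (fromℕ m))
  star-to-last zero f steps zero = ε
  star-to-last (suc m) f steps zero = steps zero ◅ star-to-last m (f ∘ suc) (steps ∘ suc) zero
  star-to-last (suc m) f steps (suc i) = star-to-last m (f ∘ suc) (steps ∘ suc) i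

HasEdgeIn : List (TEdge n) → Fin n → Fin n → ℕ → Set
HasEdgeIn L x y t = (tedge x y t ∈ L) ⊎ (tedge y x t ∈ L)

data JourneyAfterIn (L : List (TEdge n)) : ℕ → Fin n → Fin n → Set where
  here : ∀ {t x} → JourneyAfterIn L t x x
  step : ∀ {t s x y z} → HasEdgeIn L x y s → t < s → JourneyAfterIn L s y z → JourneyAfterIn L t x z

JourneyIn : List (TEdge n) → Fin n → Fin n → Set
JourneyIn L = JourneyAfterIn L 0

journeyAfter⇒journeyAfterIn : {G : TemporalGraph n} → ∀ {t x y} →
  JourneyAfter G t x y → JourneyAfterIn (edges G) t x y
journeyAfter⇒journeyAfterIn here = here
journeyAfter⇒journeyAfterIn (step e t<s j) = step e t<s (journeyAfter⇒journeyAfterIn j)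

Linked : List (TEdge n) → Fin n → Fin n → Set
Linked L = Star (λ x y → ∃[ t ] HasEdgeIn L x y t)

Linked-sym : ∀ {x y} → Linked L x y → Linked L y x
Linked-sym = reverse λ (t , e) → t , swap e

Linked-[] : ∀ {x y : Fin n} → Linked [] x y → x ≡ y
Linked-[] ε = refl
Linked-[] ((_ , inj₁ ()) ◅ _)
Linked-[] ((_ , inj₂ ()) ◅ _)

journey⇒linked : ∀ {t x y} → JourneyAfterIn L t x y → Linked L x y
journey⇒linked here = ε
journey⇒linked (step e _ j) = (_ , e) ◅ journey⇒linked j

LinkedVia : List (TEdge n) → TEdge n → Fin n → Fin n → Set
LinkedVia L g u v = Linked L u v ⊎
  ((Linked L u (end₁ g) × Linked L (end₂ g) v) ⊎ (Linked L u (end₂ g) × Linked L (end₁ g) v))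

hasEdge-split : ∀ {g a c s} → L ⊆ g ∷ L' → HasEdgeIn L a c s →
  HasEdgeIn L' a c s ⊎ (tedge a c s ≡ g ⊎ tedge c a s ≡ g)
hasEdge-split sub (inj₁ e) with sub e
... | here e≡g = inj₂ (inj₁ e≡g)
... | there e' = inj₁ (inj₁ e')
hasEdge-split sub (inj₂ e) with sub e
... | here e≡g = inj₂ (inj₂ e≡g)
... | there e' = inj₁ (inj₂ e')

linked-split : ∀ {g u v} → L ⊆ g ∷ L' → Linked L u v → LinkedVia L' g u v
linked-split sub ε = inj₁ ε
linked-split sub ((s , e) ◅ p) with hasEdge-split sub e | linked-split sub p
... | inj₁ e' | via = Sum.map (edge ◅_) (Sum.map (map₁ (edge ◅_)) (map₁ (edge ◅_))) via
  where edge = s , e'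
... | inj₂ (inj₁ refl) | inj₁ wv = inj₂ (inj₁ (ε , wv))
... | inj₂ (inj₁ refl) | inj₂ (inj₁ (_ , bv)) = inj₂ (inj₁ (ε , bv))
... | inj₂ (inj₁ refl) | inj₂ (inj₂ (_ , av)) = inj₁ av
... | inj₂ (inj₂ refl) | inj₁ wv = inj₂ (inj₂ (ε , wv))
... | inj₂ (inj₂ refl) | inj₂ (inj₁ (_ , bv)) = inj₁ bv
... | inj₂ (inj₂ refl) | inj₂ (inj₂ (_ , av)) = inj₂ (inj₂ (ε , av))

linked-avoiding : ∀ {g u v} → L ⊆ g ∷ L' → Linked L u v →
  ¬ Linked L' u (end₂ g) → ¬ Linked L' v (end₂ g) → Linked L' u v
linked-avoiding sub uv ¬ub ¬vb with linked-split sub uv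
... | inj₁ uv' = uv'
... | inj₂ (inj₁ (_ , bv)) = ⊥-elim (¬vb (Linked-sym bv))
... | inj₂ (inj₂ (ub , _)) = ⊥-elim (¬ub ub)

linked-bridged : ∀ {g u v} → L ⊆ g ∷ L' → Linked L' (end₁ g) (end₂ g) →
  Linked L u v → Linked L' u v
linked-bridged sub ab uv with linked-split sub uv
... | inj₁ uv' = uv'
... | inj₂ (inj₁ (ua , bv)) = ua ◅◅ ab ◅◅ bv
... | inj₂ (inj₂ (ub , av)) = ub ◅◅ Linked-sym ab ◅◅ av

Independent : List (TEdge n) → List (Fin n) → Set
Independent L = AllPairs (λ u v → ¬ Linked L u v)

-- At most n − |L| components: the footprint of L is a forest and no two edges of L are parallel.
Forest : List (TEdge n) → Set
Forest {n} L = ∀ C → Independent L C → length C + length L ≤ n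

independent-addEdge : ∀ {g C} → L ⊆ g ∷ L' →
  Decidable (λ v → Linked L' v (end₂ g)) → Independent L' C →
  ∃[ D ] (Independent L D × length C ≤ suc (length D))
independent-addEdge {C = C} sub linked? indep =
  filter (∁? linked?) C ,
  AllPairs-strengthen (λ ¬ub ¬vb ¬uv uv → ¬uv (linked-avoiding sub uv ¬ub ¬vb))
    (all-filter (∁? linked?) C) (filter⁺ (∁? linked?) indep) ,
  length≤1+length-filter (∁? linked?)
    (λ ¬¬ub ¬¬vb ¬uv → ¬¬ub λ ub → ¬¬vb λ vb → ¬uv (ub ◅◅ Linked-sym vb)) indep

independent-bridged : ∀ {g C} → L ⊆ g ∷ L' → Linked L' (end₁ g) (end₂ g) →
  Independent L' C → Independent L C
independent-bridged sub ab = AllPairs.map (λ ¬uv uv → ¬uv (linked-bridged sub ab uv))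

independence-bound : (L : List (TEdge n)) → ¬ ¬ (∃[ C ] (Independent L C × n ≤ length C + length L))
independence-bound {n} [] =
  pure (allFin n , AllPairs.map (λ u≢v → u≢v ∘ Linked-[]) (allFin⁺ n) , n≤)
  where
  n≤ : n ≤ length (allFin n) + 0
  n≤ = ≤-reflexive (sym (trans (+-identityʳ _) (length-tabulate (λ i → i))))
independence-bound {n} (g ∷ L) = do
  (C , indep , n≤) ← independence-bound L
  linked? ← ¬¬-Π-Fin (λ _ → ¬¬-excluded-middle)
  let (D , indep' , C≤1+D) = independent-addEdge (λ e → e) linked? indep
  pure (D , indep' , (begin
    n                                ≤⟨ n≤ ⟩
    length C + length L              ≤⟨ +-monoˡ-≤ (length L) C≤1+D ⟩
    suc (length D) + length L        ≡⟨ sym (+-suc (length D) (length L)) ⟩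
    length D + length (g ∷ L)        ∎))
  where open ≤-Reasoning

module _ {L L' : List (TEdge n)} {g : TEdge n} (sub : L ⊆ g ∷ L')
         (len : length L ≡ suc (length L')) where

  forest-rest : Forest L → Forest L'
  forest-rest forest C indep = decidable-stable (_ ≤? n) do
    linked? ← ¬¬-Π-Fin (λ _ → ¬¬-excluded-middle)
    let (D , indep' , C≤1+D) = independent-addEdge sub linked? indep
    pure (begin
      length C + length L'         ≤⟨ +-monoˡ-≤ (length L') C≤1+D ⟩
      suc (length D) + length L'   ≡⟨ sym (+-suc (length D) (length L')) ⟩
      length D + suc (length L')   ≡⟨ cong (length D +_) (sym len) ⟩
      length D + length L          ≤⟨ forest D indep' ⟩
      n                            ∎)
    where open ≤-Reasoning

  forest-bridge : Forest L → ¬ Linked L' (end₁ g) (end₂ g)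
  forest-bridge forest ab = independence-bound L' λ (C , indep , n≤) →
    <-irrefl refl (begin-strict
      n                            ≤⟨ n≤ ⟩
      length C + length L'         <⟨ n<1+n _ ⟩
      suc (length C + length L')   ≡⟨ sym (+-suc (length C) (length L')) ⟩
      length C + suc (length L')   ≡⟨ cong (length C +_) (sym len) ⟩
      length C + length L          ≤⟨ forest C (independent-bridged sub ab indep) ⟩
      n                            ∎)
    where open ≤-Reasoning

latest-split : (e : TEdge n) (L : List (TEdge n)) →
  ∃₂ λ g L' → (e ∷ L ↭ g ∷ L') × All (λ h → time h ≤ time g) (e ∷ L)
latest-split e L =
  let (L' , e∷L↭) = ∈-∃↭ (argmax-∈ time e L) in
  argmax time e L , L' , e∷L↭ ,
  f[⊥]≤f[argmax] {f = time} e L ∷ f[xs]≤f[argmax] {f = time} e L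

ArrivesAcross : List (TEdge n) → Fin n → Fin n → ℕ → Fin n → Fin n → Set
ArrivesAcross L x y t a b = (JourneyAfterIn L t a x × b ≡ y) ⊎ (JourneyAfterIn L t a y × b ≡ x)

journey-after-latest : ∀ {T a b} → All (λ h → time h ≤ T) L → JourneyAfterIn L T a b → a ≡ b
journey-after-latest latest here = refl
journey-after-latest latest (step e T<s _) =
  ⊥-elim (<⇒≱ T<s (Sum.[ All.lookup latest , All.lookup latest ] e))

journey-lastHop : ∀ {g t a b} → L ⊆ g ∷ L' → All (λ h → time h ≤ time g) L →
  JourneyAfterIn L t a b → JourneyAfterIn L' t a b ⊎ ArrivesAcross L' (end₁ g) (end₂ g) t a b
journey-lastHop sub latest here = inj₁ here
journey-lastHop sub latest (step e t<s j) with hasEdge-split sub e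
... | inj₁ e' = Sum.map (step e' t<s) (Sum.map (map₁ (step e' t<s)) (map₁ (step e' t<s)))
                  (journey-lastHop sub latest j)
... | inj₂ (inj₁ refl) = inj₂ (inj₁ (here , sym (journey-after-latest latest j)))
... | inj₂ (inj₂ refl) = inj₂ (inj₂ (here , sym (journey-after-latest latest j)))

JourneyWithin : List (TEdge n) → Pred (Fin n) 0ℓ → Fin n → Fin n → Set
JourneyWithin L S u v = S u × S v × JourneyIn L u v

JourneyConnected : List (TEdge n) → Pred (Fin n) 0ℓ → Set
JourneyConnected L S = ∀ {u v} → S u → S v → Star (JourneyWithin L S) u v

JourneyConnected⇒Linked : ∀ {S u v} → JourneyConnected L S → S u → S v → Linked L u v
JourneyConnected⇒Linked connected su sv =
  Star.fold (Linked _) (λ (_ , _ , j) → journey⇒linked j ◅◅_) ε (connected su sv)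

JourneyConnected-inComponent : ∀ {S z w} → JourneyConnected L S → S w → Linked L z w →
  ∀ {v} → S v → Linked L z v
JourneyConnected-inComponent connected sw zw sv = zw ◅◅ JourneyConnected⇒Linked connected sw sv

JourneyConnected-∩ : ∀ {S T} → JourneyConnected L S → (∀ {v} → S v → T v) →
  JourneyConnected L (S ∩ T)
JourneyConnected-∩ connected S⊆T (su , _) (sv , _) =
  Star.map (λ (su , sv , j) → (su , S⊆T su) , (sv , S⊆T sv) , j) (connected su sv)

-- Double negated because the induction argues classically; the common vertex of closed walks is
-- decidable, so this costs nothing at the end.
HellyProperty : List (TEdge n) → Set₁
HellyProperty {n} L = ∀ {k} (F : Fin k → Pred (Fin n) 0ℓ) → Fin k →
  (∀ i → JourneyConnected L (F i)) → (∀ i j → ∃[ v ] (F i v × F j v)) →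
  ¬ ¬ (∃[ v ] ∀ i → F i v)

helly-[] : HellyProperty {n} []
helly-[] F i₀ connected meets =
  let (v , f₀v , _) = meets i₀ i₀ in
  pure (v , λ i →
    let (w , fw , f₀w) = meets i i₀ in
    subst (F i) (sym (Linked-[] (JourneyConnected⇒Linked (connected i₀) f₀v f₀w))) fw)

module Side {L L' : List (TEdge n)} {x y : Fin n}
  (lastHop : ∀ {t a b} → JourneyAfterIn L t a b → JourneyAfterIn L' t a b ⊎ ArrivesAcross L' x y t a b)
  (bridge : ¬ Linked L' x y) where

  X Y : Pred (Fin n) 0ℓ
  X = Linked L' x
  Y = Linked L' y

  X∩Y=∅ : ∀ {v} → X v → Y v → ⊥
  X∩Y=∅ xv yv = bridge (xv ◅◅ Linked-sym yv)

  journey-preserves-X∪Y : ∀ {c d} → X c ⊎ Y c → JourneyIn L c d → X d ⊎ Y d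
  journey-preserves-X∪Y side j with lastHop j
  ... | inj₁ j' = Sum.map (_◅◅ journey⇒linked j') (_◅◅ journey⇒linked j') side
  ... | inj₂ (inj₁ (_ , refl)) = inj₂ ε
  ... | inj₂ (inj₂ (_ , refl)) = inj₁ ε

  chain-from-Y-to-X-visits-x : ∀ {S c d} → Star (JourneyWithin L S) c d → Y c → X d → S x
  chain-from-Y-to-X-visits-x ε yc xc = ⊥-elim (X∩Y=∅ xc yc)
  chain-from-Y-to-X-visits-x ((_ , se , j) ◅ chain) yc xd with lastHop j
  ... | inj₁ j' = chain-from-Y-to-X-visits-x chain (yc ◅◅ journey⇒linked j') xd
  ... | inj₂ (inj₁ (c⇝x , refl)) = ⊥-elim (X∩Y=∅ (Linked-sym (journey⇒linked c⇝x)) yc)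
  ... | inj₂ (inj₂ (_ , refl)) = se

  chain-preserves-X∪Y : ∀ {S c d} → Star (JourneyWithin L S) c d → X c ⊎ Y c → X d ⊎ Y d
  chain-preserves-X∪Y ε side = side
  chain-preserves-X∪Y ((_ , _ , j) ◅ chain) side =
    chain-preserves-X∪Y chain (journey-preserves-X∪Y side j)

  crossing-straddles : ∀ {S a} → JourneyConnected L S → S a → S y → JourneyIn L' a x →
    S x × (∀ {v} → S v → X v ⊎ Y v)
  crossing-straddles connected sa sy a⇝x =
    chain-from-Y-to-X-visits-x (connected sy sa) ε xa ,
    λ sv → chain-preserves-X∪Y (connected sa sv) (inj₁ xa)
    where
    xa = Linked-sym (journey⇒linked a⇝x)

  -- Collapses Y onto x. A journey inside S between the two sides either crosses to y through x or
  -- lands on x from Y, so chains of L-journeys in S retract to chains of L'-journeys in S ∩ X.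
  retract : ∀ {c} → X c ⊎ Y c → Fin n
  retract {c} (inj₁ _) = c
  retract (inj₂ _) = x

  retract-unique : ∀ {c} (side side' : X c ⊎ Y c) → retract side ≡ retract side'
  retract-unique (inj₁ _) (inj₁ _) = refl
  retract-unique (inj₂ _) (inj₂ _) = refl
  retract-unique (inj₁ xc) (inj₂ yc) = ⊥-elim (X∩Y=∅ xc yc)
  retract-unique (inj₂ yc) (inj₁ xc) = ⊥-elim (X∩Y=∅ xc yc)

  module _ {S : Pred (Fin n) 0ℓ} (sx : S x) where

    Retracted : Rel (Fin n) 0ℓ
    Retracted = Star (JourneyWithin L' (S ∩ X))

    realign : ∀ {c d} (sc' sc : X c ⊎ Y c) (sd' sd : X d ⊎ Y d) →
      Retracted (retract sc') (retract sd') → Retracted (retract sc) (retract sd)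
    realign sc' sc sd' sd = subst₂ Retracted (retract-unique sc' sc) (retract-unique sd' sd)

    journey-retracts : ∀ {c d} → S c → S d → JourneyIn L c d → (sc : X c ⊎ Y c) (sd : X d ⊎ Y d) →
      Retracted (retract sc) (retract sd)
    journey-retracts fc fd j sc sd with lastHop j | sc
    ... | inj₁ j' | inj₁ xc =
      realign (inj₁ xc) (inj₁ xc) (inj₁ xd) sd (((fc , xc) , (fd , xd) , j') ◅ ε)
      where xd = xc ◅◅ journey⇒linked j'
    ... | inj₁ j' | inj₂ yc = realign (inj₂ yc) (inj₂ yc) (inj₂ (yc ◅◅ journey⇒linked j')) sd ε
    ... | inj₂ (inj₁ (c⇝x , refl)) | sc' =
      realign (inj₁ xc) sc' (inj₂ ε) sd (((fc , xc) , (sx , ε) , c⇝x) ◅ ε)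
      where xc = Linked-sym (journey⇒linked c⇝x)
    ... | inj₂ (inj₂ (c⇝y , refl)) | sc' =
      realign (inj₂ (Linked-sym (journey⇒linked c⇝y))) sc' (inj₁ ε) sd ε

    chain-retracts : ∀ {c d} → (∀ {v} → S v → X v ⊎ Y v) → Star (JourneyWithin L S) c d →
      (sc : X c ⊎ Y c) (sd : X d ⊎ Y d) → Retracted (retract sc) (retract sd)
    chain-retracts side ε sc sd = subst (Retracted _) (retract-unique sc sd) ε
    chain-retracts side ((fc , fe , j) ◅ chain) sc sd =
      journey-retracts fc fe j sc (side fe) ◅◅ chain-retracts side chain (side fe) sd

  project : ∀ {S} → JourneyConnected L S → S x → (∀ {v} → S v → X v ⊎ Y v) →
    JourneyConnected L' (S ∩ X)
  project connected sx side (fu , xu) (fv , xv) =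
    chain-retracts sx side (connected fu fv) (inj₁ xu) (inj₁ xv)

  Trimmable : Pred (Fin n) 0ℓ → Set
  Trimmable S = (S x × (∀ {v} → S v → X v ⊎ Y v)) ⊎ (JourneyConnected L' S × (∀ {v} → S v → X v))

  helly-trimmed : HellyProperty L' → ∀ {k} (F : Fin k → Pred (Fin n) 0ℓ) → Fin k →
    (∀ i → JourneyConnected L (F i)) → (∀ i j → ∃[ v ] (F i v × F j v)) → (∀ i → Trimmable (F i)) →
    ¬ ¬ (∃[ v ] ∀ i → F i v)
  helly-trimmed IH F i₀ connected meets trimmable =
    ¬¬-map (λ (v , in-all) → v , proj₁ ∘ in-all) (IH (λ i → F i ∩ X) i₀ connected' meets')
    where
    connected' : ∀ i → JourneyConnected L' (F i ∩ X)
    connected' i with trimmable i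
    ... | inj₁ (fx , side) = project (connected i) fx side
    ... | inj₂ (connectedL' , F⊆X) = JourneyConnected-∩ connectedL' F⊆X

    meets' : ∀ i j → ∃[ v ] ((F i ∩ X) v × (F j ∩ X) v)
    meets' i j with trimmable i | trimmable j | meets i j
    ... | inj₁ (fx , _) | inj₁ (fx' , _) | _ = x , (fx , ε) , (fx' , ε)
    ... | inj₂ (_ , F⊆X) | _ | v , fv , fv' = v , (fv , F⊆X fv) , (fv' , F⊆X fv)
    ... | inj₁ _ | inj₂ (_ , F⊆X) | v , fv , fv' = v , (fv , F⊆X fv') , (fv' , F⊆X fv')

module HellyStep {L L' : List (TEdge n)} {x y : Fin n}
  (lastHop : ∀ {t a b} → JourneyAfterIn L t a b → JourneyAfterIn L' t a b ⊎ ArrivesAcross L' x y t a b)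
  (bridge : ¬ Linked L' x y) where

  module SX = Side lastHop bridge
  module SY = Side (Sum.map₂ swap ∘ lastHop) (bridge ∘ Linked-sym)
  open SX using (X; Y)

  Straddles : Pred (Fin n) 0ℓ → Set
  Straddles S = S x × S y × (∀ {v} → S v → X v ⊎ Y v)

  crossing-straddles : ∀ {S a b} → JourneyConnected L S → S a → S b → ArrivesAcross L' x y 0 a b →
    Straddles S
  crossing-straddles connected sa sb (inj₁ (a⇝x , refl)) =
    let (sx , side) = SX.crossing-straddles connected sa sb a⇝x in sx , sb , side
  crossing-straddles connected sa sb (inj₂ (a⇝y , refl)) =
    let (sy , side) = SY.crossing-straddles connected sa sb a⇝y in sb , sy , swap ∘ side

  nonStraddling-connected : ∀ {S} → JourneyConnected L S → ¬ Straddles S → JourneyConnected L' S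
  nonStraddling-connected {S} connected ¬straddles su sv = Star.map avoid (connected su sv)
    where
    avoid : ∀ {c d} → JourneyWithin L S c d → JourneyWithin L' S c d
    avoid (sc , sd , j) with lastHop j
    ... | inj₁ j' = sc , sd , j'
    ... | inj₂ crossing = ⊥-elim (¬straddles (crossing-straddles connected sc sd crossing))

  NonStraddlingInY : Pred (Fin n) 0ℓ → Set
  NonStraddlingInY S = ¬ Straddles S × (∀ {v} → S v → Y v)

  module Family {k} (F : Fin k → Pred (Fin n) 0ℓ) (connected : ∀ i → JourneyConnected L (F i))
           (meets : ∀ i j → ∃[ v ] (F i v × F j v)) (straddles? : ∀ i → Dec (Straddles (F i))) where

    connectedL' : ∀ i → ¬ Straddles (F i) → JourneyConnected L' (F i)
    connectedL' i = nonStraddling-connected (connected i)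

    inComponent : ∀ i → ¬ Straddles (F i) → ∀ {z w} → F i w → Linked L' z w → ∀ {v} → F i v → Linked L' z v
    inComponent i ¬straddles = JourneyConnected-inComponent (connectedL' i ¬straddles)

    trimmable-X : ∀ {c} → Straddles (F c) → ¬ (∃[ i ] NonStraddlingInY (F i)) → ∀ i → SX.Trimmable (F i)
    trimmable-X {c} (_ , _ , side) ¬inY i with straddles? i | meets i c
    ... | yes (fx , _ , side') | _ = inj₁ (fx , side')
    ... | no ¬straddles | w , fw , fcw with side fcw
    ...   | inj₁ xw = inj₂ (connectedL' i ¬straddles , inComponent i ¬straddles fw xw)
    ...   | inj₂ yw = ⊥-elim (¬inY (i , ¬straddles , inComponent i ¬straddles fw yw))

    trimmable-Y : ∀ {i₁} → NonStraddlingInY (F i₁) → ∀ i → SY.Trimmable (F i)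
    trimmable-Y {i₁} (_ , F₁⊆Y) i with straddles? i | meets i i₁
    ... | yes (_ , fy , side) | _ = inj₁ (fy , swap ∘ side)
    ... | no ¬straddles | u , fu , f₁u =
      inj₂ (connectedL' i ¬straddles , inComponent i ¬straddles fu (F₁⊆Y f₁u))

  helly-step : HellyProperty L' → HellyProperty L
  helly-step IH F i₀ connected meets = do
    straddles? ← ¬¬-Π-Fin (λ i → ¬¬-excluded-middle {A = Straddles (F i)})
    let open Family F connected meets straddles?
    yes (c , straddles) ← ¬¬-excluded-middle {A = ∃[ i ] Straddles (F i)}
      where no ¬straddles →
              IH F i₀ (λ i → nonStraddling-connected (connected i) (¬straddles ∘ (i ,_))) meets
    yes (i₁ , inY) ← ¬¬-excluded-middle {A = ∃[ i ] NonStraddlingInY (F i)}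
      where no ¬inY →
              SX.helly-trimmed IH F i₀ connected meets (trimmable-X straddles ¬inY)
    SY.helly-trimmed IH F i₀ connected meets (trimmable-Y inY)

forest-helly : ∀ m (L : List (TEdge n)) → length L ≡ m → Forest L → HellyProperty L
forest-helly _ [] _ _ = helly-[]
forest-helly (suc m) (e ∷ L) len forest with latest-split e L
... | g , L' , e∷L↭ , latest =
  HellyStep.helly-step (journey-lastHop sub latest) (forest-bridge sub len' forest)
    (forest-helly m L' (suc-injective (trans (sym len') len)) (forest-rest sub len' forest))
  where
  sub : e ∷ L ⊆ g ∷ L'
  sub = ∈-resp-↭ e∷L↭
  len' : length (e ∷ L) ≡ suc (length L')
  len' = ↭-length e∷L↭

module _ {R : Digraph n} {G : TemporalGraph n} (solution : IsSolution R G) where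

  arc-journey : ∀ {u v} → R u v → JourneyIn (edges G) u v
  arc-journey r = journeyAfter⇒journeyAfterIn (solution _ _ r)

  closedWalk-journeyConnected : (W : ClosedWalk R) → JourneyConnected (edges G) (λ v → OnWalk v W)
  closedWalk-journeyConnected W (i , refl) (j , refl) =
    star-to-last (len W) (vertex W) steps i ◅◅
    subst (λ v → Star (JourneyWithin (edges G) OnW) v (vertex W j)) (sym (closed W))
      (star-from-zero (len W) (vertex W) steps j)
    where
    OnW : Pred (Fin n) 0ℓ
    OnW v = OnWalk v W
    steps : ∀ i → JourneyWithin (edges G) OnW (vertex W (inject₁ i)) (vertex W (suc i))
    steps i = (inject₁ i , refl) , (suc i , refl) , arc-journey (arcs W i)

  connected-linked : Connected R → ∀ u v → Linked (edges G) u v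
  connected-linked connected u v = Star.fold (Linked _) (λ r → arcOrReverse r ◅◅_) ε (connected u v)
    where
    arcOrReverse : ∀ {a b} → R a b ⊎ R b a → Linked (edges G) a b
    arcOrReverse (inj₁ r) = journey⇒linked (arc-journey r)
    arcOrReverse (inj₂ r) = Linked-sym (journey⇒linked (arc-journey r))

  tree-forest : Connected R → length (edges G) ≡ n ∸ 1 → Forest (edges G)
  tree-forest connected len [] _ = subst (_≤ n) (sym len) (m∸n≤m n 1)
  tree-forest connected len (c ∷ []) _ =
    ≤-reflexive (trans (cong suc len) (suc-pred n {{nonZeroIndex c}}))
  tree-forest connected len (c ∷ d ∷ _) ((¬cd ∷ _) ∷ _) = ⊥-elim (¬cd (connected-linked connected c d))

proposition4p13 : (n : ℕ) (R : Digraph n) → Loopless R → Connected R →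
    ∃[ G ] IsTreeSolution R G → WalkHelly R
proposition4p13 n R _ connected (G , solution , len) Ws (_ , W∈Ws) meet =
  let (v , onAll) = decidable-stable common? helly in
  v , λ W∈ → subst (OnWalk v) (sym (lookup-index W∈)) (onAll (index W∈))
  where
  F : Fin (length Ws) → Pred (Fin n) 0ℓ
  F i v = OnWalk v (lookup Ws i)

  common? : Dec (∃[ v ] ∀ i → F i v)
  common? = any? λ v → all? λ i → any? λ j → vertex (lookup Ws i) j ≟ v

  helly : ¬ ¬ (∃[ v ] ∀ i → F i v)
  helly = forest-helly _ (edges G) refl (tree-forest solution connected len) F (index W∈Ws)
    (closedWalk-journeyConnected solution ∘ lookup Ws) (λ i j → meet (∈-lookup i) (∈-lookup j))
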